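{- For the elementary cellular automaton $F_{184}$, $D(\textsc{Pred}_{F_{184},n})\in O(\log n)$, and this bound is optimal, i.e. $D(\textsc{Pred}_{F_{184},n})\in\Theta(\log n)$.
   Context: The ECA with Wolfram number $N$ is $F_N:\{0,1\}^{\mathbb{Z}}\to\{0,1\}^{\mathbb{Z}}$, $(F_N(x))_i=f_N(x_{i-1},x_i,x_{i+1})$, where $f_N(a,b,c)$ is the bit of index $4a+2b+c$ of $N$ in binary. On a finite word of length $m$, $F_N$ returns the word of length $m-2$ obtained by applying $f_N$ wherever it is defined. $\textsc{Pred}_{F,n}:\{0,1\}^{2n+1}\to\{0,1\}$ maps $x$ to the unique cell of $F^n(x)$. For finite sets $X,Y,Z$ and $g:X\times Y\to Z$, $D(g)$ is the minimal depth of a deterministic two-party communication protocol tree computing $g$ (Alice knows $x$, Bob knows $y$; internal nodes are labelled by a function of $x$ alone or of $y$ alone to $\{\mathrm{l},\mathrm{r}\}$ selecting the child, leaves are labelled by outputs). For $g:\{0,1\}^m\to Z$, $D(g)=\max_{0\le i\le m} D(g_i)$ where $g_i:\{0,1\}^i\times\{0,1\}^{m-i}\to Z$, $g_i(x,y)=g(xy)$. -}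

module Defs where

open import Data.Bool using (Bool; true; false; if_then_else_)
open import Data.Nat using (ℕ; zero; suc; _+_; _*_; _^_; _≡ᵇ_; _≤_)
open import Data.Nat.DivMod using (_/_; _%_)
open import Data.List using (List; []; _∷_)
open import Data.Vec using (Vec; toList; _++_)
open import Data.Product using (Σ; _×_; _,_; ∃)
open import Relation.Binary.PropositionalEquality using (_≡_; subst)

bitℕ : Bool → ℕ
bitℕ false = 0
bitℕ true  = 1

testBit : ℕ → ℕ → Bool
testBit N zero    = (N % 2) ≡ᵇ 1
testBit N (suc k) = testBit (N / 2) k

localRule : ℕ → Bool → Bool → Bool → Bool
localRule N a b c = testBit N (4 * bitℕ a + 2 * bitℕ b + bitℕ c)

-- F_N on a finite word: length m ↦ length m-2
ecaStep : ℕ → List Bool → List Bool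
ecaStep N (a ∷ b ∷ c ∷ rest) = localRule N a b c ∷ ecaStep N (b ∷ c ∷ rest)
ecaStep N _ = []

iterate : ℕ → ℕ → List Bool → List Bool
iterate N zero    w = w
iterate N (suc n) w = iterate N n (ecaStep N w)

headOr : List Bool → Bool
headOr []      = false
headOr (b ∷ _) = b

-- Pred_{F_N,n} : {0,1}^{2n+1} → {0,1}: the unique cell of F_N^n(x)
-- (F_N^n(x) has length exactly 1, so headOr returns that cell)
Pred : ℕ → (n : ℕ) → Vec Bool (2 * n + 1) → Bool
Pred N n x = headOr (iterate N n (toList x))

data Protocol (X Y Z : Set) : Set where
  leaf  : Z → Protocol X Y Z
  alice : (X → Bool) → Protocol X Y Z → Protocol X Y Z → Protocol X Y Z
  bob   : (Y → Bool) → Protocol X Y Z → Protocol X Y Z → Protocol X Y Z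

run : ∀ {X Y Z} → Protocol X Y Z → X → Y → Z
run (leaf z)      x y = z
run (alice f l r) x y = if f x then run r x y else run l x y
run (bob g l r)   x y = if g y then run r x y else run l x y

depth : ∀ {X Y Z} → Protocol X Y Z → ℕ
depth (leaf _)      = 0
depth (alice _ l r) = suc (depth l Data.Nat.⊔ depth r)
depth (bob _ l r)   = suc (depth l Data.Nat.⊔ depth r)

Computes : ∀ {X Y Z} → Protocol X Y Z → (X → Y → Z) → Set
Computes p g = ∀ x y → run p x y ≡ g x y

D₂≤ : ∀ {X Y Z} → (X → Y → Z) → ℕ → Set
D₂≤ {X} {Y} {Z} g d = Σ (Protocol X Y Z) λ p → Computes p g × depth p ≤ d

cut : ∀ {Z : Set} {m} → (Vec Bool m → Z) → (i j : ℕ) → i + j ≡ m →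
      Vec Bool i → Vec Bool j → Z
cut g i j e x y = g (subst (Vec Bool) e (x ++ y))

D≤ : ∀ {Z : Set} {m} → (Vec Bool m → Z) → ℕ → Set
D≤ {Z} {m} g d = ∀ i j (e : i + j ≡ m) → D₂≤ (cut g i j e) d

DLower : ∀ {Z : Set} {m} → (Vec Bool m → Z) → ℕ → ℕ → Set
DLower {Z} {m} g c k = Σ ℕ λ i → Σ ℕ λ j → Σ (i + j ≡ m) λ e →
  ∀ (p : Protocol (Vec Bool i) (Vec Bool j) Z) → Computes p (cut g i j e) → k ≤ c * depth p

-- Encode a word as a height profile: starting from a height h ≥ its length, read 1 as a step up and
-- 0 as a step down.  On profiles rule 184 becomes h′ᵢ = max(hᵢ , hᵢ₊₂), which preserves the parity of
-- the first height and the maximum, so after n steps the single surviving cell is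
-- odd (first height) xor odd (maximum).
-- Upper bound: the maximum over x ++ y is max(max over x, max over y started at the end height of x),
-- so Alice announces two numbers below 4n + 3 and Bob answers.
-- Lower bound: on the inputs 1^(2u) 0^(n+1-2u) | 0^t 1^(n-t) the profile peaks at an odd height
-- after Alice's ascent or ends at an even height after Bob's, whichever is larger, so the cut computes
-- t < u; greater-than on ⌊n/2⌋ values has a fooling set of that size, forcing 2 ^ depth ≥ ⌊n/2⌋.
module Submission where

open import Defs
open import Algebra.Bundles using (IdempotentCommutativeMonoid)
open import Data.Bool using (Bool; true; false; not; _xor_; if_then_else_)
import Data.Bool as Bool
open import Data.Bool.Properties using (not-involutive; not-distribˡ-xor; not-distribʳ-xor; xor-same)
open import Data.Empty using (⊥; ⊥-elim)
open import Data.List using (List; []; _∷_; length; foldr; _++_; replicate; filter; applyUpTo)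
open import Data.List.Properties using (length-++; ++-assoc; ++-identityʳ; length-applyUpTo)
open import Data.List.Relation.Unary.All as All using (All; []; _∷_)
open import Data.List.Relation.Unary.All.Properties using (all-filter)
open import Data.List.Relation.Unary.AllPairs using (AllPairs; []; _∷_)
import Data.List.Relation.Unary.AllPairs.Properties as AllPairs
open import Data.List.Relation.Unary.Linked using (Linked; []; [-]; _∷_)
open import Data.Nat
open import Data.Nat.Logarithm using (⌊log₂_⌋; ⌊log₂⌋-mono-≤; ⌊log₂[2^n]⌋≡n; ⌊log₂⌊n/2⌋⌋≡⌊log₂n⌋∸1)
open import Data.Nat.Properties
open import Data.Nat.Tactic.RingSolver using (solve-∀)
open import Data.Product using (Σ; _×_; _,_; proj₁; proj₂)
open import Data.Sum using (inj₁; inj₂)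
open import Data.Vec using (Vec; toList; []; _∷_)
open import Data.Vec.Properties using (toList-++; length-toList)
open import Function using (_∘_; _$_)
open import Relation.Binary.PropositionalEquality
open import Relation.Nullary using (yes; no; contradiction)
open import Relation.Nullary.Decidable using (dec-true; dec-false)
open import Relation.Nullary.Reflects using (ofʸ; ofⁿ)

⊔-0-idempotentCommutativeMonoid : IdempotentCommutativeMonoid _ _
⊔-0-idempotentCommutativeMonoid = record
  { isIdempotentCommutativeMonoid = record { isCommutativeMonoid = ⊔-0-isCommutativeMonoid ; idem = ⊔-idem } }

open import Algebra.Solver.IdempotentCommutativeMonoid ⊔-0-idempotentCommutativeMonoid
  using (solve; _⊕_; _⊜_; id)

data Step : ℕ → ℕ → Set where
  up   : ∀ {h} → Step h (suc h)
  down : ∀ {h} → Step (suc h) h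

step-suc : ∀ {a b} → Step a b → Step (suc a) (suc b)
step-suc up   = up
step-suc down = down

odd : ℕ → Bool
odd zero    = false
odd (suc n) = not (odd n)

odd-step : ∀ {a b} → Step a b → odd b ≡ not (odd a)
odd-step up   = refl
odd-step down = sym (not-involutive _)

odd-+ : ∀ m n → odd (m + n) ≡ odd m xor odd n
odd-+ zero    n = refl
odd-+ (suc m) n = trans (cong not (odd-+ m n)) (not-distribˡ-xor (odd m) (odd n))

odd-2* : ∀ n → odd (2 * n) ≡ false
odd-2* n = begin
  odd (n + (n + 0))       ≡⟨ odd-+ n (n + 0) ⟩
  odd n xor odd (n + 0)   ≡⟨ cong (λ k → odd n xor odd k) (+-identityʳ n) ⟩
  odd n xor odd n         ≡⟨ xor-same (odd n) ⟩
  false                   ∎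
  where open ≡-Reasoning

odd-2*+1 : ∀ n → odd (2 * n + 1) ≡ true
odd-2*+1 n = trans (odd-+ (2 * n) 1) (cong (_xor true) (odd-2* n))

slopes : List ℕ → List Bool
slopes (a ∷ b ∷ hs) = (a <ᵇ b) ∷ slopes (b ∷ hs)
slopes _            = []

heightStep : List ℕ → List ℕ
heightStep (a ∷ b ∷ c ∷ hs) = (a ⊔ c) ∷ heightStep (b ∷ c ∷ hs)
heightStep _                = []

maximum : List ℕ → ℕ
maximum = foldr _⊔_ 0

record Rule184Window (a b c d : ℕ) : Set where
  constructor _,_
  field
    rule : localRule 184 (a <ᵇ b) (b <ᵇ c) (c <ᵇ d) ≡ (a ⊔ c <ᵇ b ⊔ d)
    step : Step (a ⊔ c) (b ⊔ d)

lift-window : ∀ {a b c d} → Rule184Window a b c d → Rule184Window (suc a) (suc b) (suc c) (suc d)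
lift-window (e , s) = e , step-suc s

-- Translation invariance (lift-window) reduces each of the eight step patterns to the one whose
-- lowest height is 0, where both sides compute.
rule184-window : ∀ {a b c d} → Step a b → Step b c → Step c d → Rule184Window a b c d
rule184-window (up {zero})    up               up               = refl , up
rule184-window (up {suc a})   up               up               = lift-window (rule184-window (up {a}) up up)
rule184-window (up {zero})    up               down             = refl , down
rule184-window (up {suc a})   up               down             = lift-window (rule184-window (up {a}) up down)
rule184-window (up {zero})    down             up               = refl , up
rule184-window (up {suc a})   down             up               = lift-window (rule184-window (up {a}) down up)
rule184-window up             down             (down {zero})    = refl , up
rule184-window up             down             (down {suc d})   = lift-window (rule184-window up down (down {d}))
rule184-window (down {zero})  up               up               = refl , up
rule184-window (down {suc b}) up               up               = lift-window (rule184-window (down {b}) up up)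
rule184-window (down {zero})  up               down             = refl , down
rule184-window (down {suc b}) up               down             = lift-window (rule184-window (down {b}) up down)
rule184-window down           (down {zero})    up               = refl , down
rule184-window down           (down {suc c})   up               = lift-window (rule184-window down (down {c}) up)
rule184-window down           down             (down {zero})    = refl , down
rule184-window down           down             (down {suc d})   = lift-window (rule184-window down down (down {d}))

xor-not-not : ∀ x y → not x xor not y ≡ x xor y
xor-not-not x y = begin
  not x xor not y     ≡⟨ not-distribˡ-xor x (not y) ⟨
  not (x xor not y)   ≡⟨ cong not (not-distribʳ-xor x y) ⟨
  not (not (x xor y)) ≡⟨ not-involutive _ ⟩
  x xor y             ∎
  where open ≡-Reasoning

slope-parity : ∀ {a b} → Step a b → (a <ᵇ b) ≡ odd a xor odd (a ⊔ b)
slope-parity (up {zero})    = refl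
slope-parity (up {suc a})   = trans (slope-parity (up {a})) (sym (xor-not-not (odd a) _))
slope-parity (down {zero})  = refl
slope-parity (down {suc b}) = trans (slope-parity (down {b})) (sym (xor-not-not (odd (suc b)) _))

heightStep-path : ∀ {hs} → Linked Step hs → Linked Step (heightStep hs)
heightStep-path (p ∷ q ∷ s ∷ ps) =
  Rule184Window.step (rule184-window p q s) ∷ heightStep-path (q ∷ s ∷ ps)
heightStep-path (_ ∷ _ ∷ [-])    = [-]
heightStep-path (_ ∷ [-])        = []
heightStep-path [-]              = []
heightStep-path []               = []

slopes-heightStep : ∀ {hs} → Linked Step hs → ecaStep 184 (slopes hs) ≡ slopes (heightStep hs)
slopes-heightStep (p ∷ q ∷ s ∷ ps) =
  cong₂ _∷_ (Rule184Window.rule (rule184-window p q s)) (slopes-heightStep (q ∷ s ∷ ps))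
slopes-heightStep (_ ∷ _ ∷ [-]) = refl
slopes-heightStep (_ ∷ [-])     = refl
slopes-heightStep [-]           = refl
slopes-heightStep []            = refl

length-heightStep : ∀ a b hs → length (heightStep (a ∷ b ∷ hs)) ≡ length hs
length-heightStep a b []       = refl
length-heightStep a b (c ∷ hs) = cong suc (length-heightStep b c hs)

maximum-heightStep : ∀ a b c d hs →
  maximum (heightStep (a ∷ b ∷ c ∷ d ∷ hs)) ≡ maximum (a ∷ b ∷ c ∷ d ∷ hs)
maximum-heightStep a b c d [] =
  solve 4 (λ a b c d → (a ⊕ c) ⊕ ((b ⊕ d) ⊕ id) ⊜ a ⊕ (b ⊕ (c ⊕ (d ⊕ id)))) refl a b c d
maximum-heightStep a b c d (e ∷ hs) =
  trans (cong (a ⊔ c ⊔_) (maximum-heightStep b c d e hs))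
        (solve 4 (λ a b c m → (a ⊕ c) ⊕ (b ⊕ (c ⊕ m)) ⊜ a ⊕ (b ⊕ (c ⊕ m)))
                 refl a b c (maximum (d ∷ e ∷ hs)))

odd-⊔-two-steps : ∀ {a b c} → Step a b → Step b c → odd (a ⊔ c) ≡ odd a
odd-⊔-two-steps {a} {b} {c} p q with ⊔-sel a c
... | inj₁ a⊔c≡a = cong odd a⊔c≡a
... | inj₂ a⊔c≡c = begin
  odd (a ⊔ c)       ≡⟨ cong odd a⊔c≡c ⟩
  odd c             ≡⟨ odd-step q ⟩
  not (odd b)       ≡⟨ cong not (odd-step p) ⟩
  not (not (odd a)) ≡⟨ not-involutive _ ⟩
  odd a             ∎
  where open ≡-Reasoning

-- The length is written suc (n * 2) because n * 2, unlike 2 * n, unfolds under suc n.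
rule184-iterate : ∀ n a hs → Linked Step (a ∷ hs) → length hs ≡ suc (n * 2) →
  headOr (iterate 184 n (slopes (a ∷ hs))) ≡ odd a xor odd (maximum (a ∷ hs))
rule184-iterate zero a (b ∷ []) (p ∷ [-]) _ =
  trans (slope-parity p) (cong (λ m → odd a xor odd (a ⊔ m)) (sym (⊔-identityʳ b)))
rule184-iterate (suc n) a (b ∷ c ∷ d ∷ hs) path@(p ∷ q ∷ _) len = begin
  headOr (iterate 184 n (ecaStep 184 (slopes H)))
    ≡⟨ cong (headOr ∘ iterate 184 n) (slopes-heightStep path) ⟩
  headOr (iterate 184 n (slopes (heightStep H)))
    ≡⟨ rule184-iterate n (a ⊔ c) _ (heightStep-path path) len′ ⟩
  odd (a ⊔ c) xor odd (maximum (heightStep H))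
    ≡⟨ cong₂ _xor_ (odd-⊔-two-steps p q) (cong odd (maximum-heightStep a b c d hs)) ⟩
  odd a xor odd (maximum H)
    ∎
  where
  open ≡-Reasoning
  H = a ∷ b ∷ c ∷ d ∷ hs
  len′ : length (heightStep (b ∷ c ∷ d ∷ hs)) ≡ suc (n * 2)
  len′ = trans (length-heightStep b c (d ∷ hs)) (suc-injective (suc-injective len))

move : Bool → ℕ → ℕ
move true  = suc
move false = pred

trail : ℕ → List Bool → List ℕ
trail h []      = []
trail h (b ∷ w) = move b h ∷ trail (move b h) w

heights : ℕ → List Bool → List ℕ
heights h w = h ∷ trail h w

endHeight : ℕ → List Bool → ℕ
endHeight h []      = h
endHeight h (b ∷ w) = endHeight (move b h) w

length-trail : ∀ h w → length (trail h w) ≡ length w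
length-trail h []      = refl
length-trail h (b ∷ w) = cong suc (length-trail (move b h) w)

-- move false is truncated: a profile only follows its word when it starts at least as high as the
-- word is long.
heights-path : ∀ h w → length w ≤ h → Linked Step (heights h w)
heights-path h       []          _         = [-]
heights-path h       (true ∷ w)  w<h       = up ∷ heights-path (suc h) w (m≤n⇒m≤1+n (<⇒≤ w<h))
heights-path (suc h) (false ∷ w) (s≤s w≤h) = down ∷ heights-path h w w≤h

slopes-heights : ∀ h w → length w ≤ h → slopes (heights h w) ≡ w
slopes-heights h       []          _         = refl
slopes-heights h       (true ∷ w)  w<h       =
  cong₂ _∷_ (dec-true (h <? suc h) (n<1+n h)) (slopes-heights (suc h) w (m≤n⇒m≤1+n (<⇒≤ w<h)))
slopes-heights (suc h) (false ∷ w) (s≤s w≤h) =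
  cong₂ _∷_ (dec-false (suc h <? h) (1+n≰n ∘ <⇒≤)) (slopes-heights h w w≤h)

pred184-maximum : ∀ n w → length w ≡ 2 * n + 1 →
  headOr (iterate 184 n w) ≡ not (odd (maximum (heights (2 * n + 1) w)))
pred184-maximum n w len = begin
  headOr (iterate 184 n w)
    ≡⟨ cong (headOr ∘ iterate 184 n) (slopes-heights B w w≤B) ⟨
  headOr (iterate 184 n (slopes (heights B w)))
    ≡⟨ rule184-iterate n B (trail B w) (heights-path B w w≤B) len′ ⟩
  odd B xor odd (maximum (heights B w))
    ≡⟨ cong (_xor odd (maximum (heights B w))) (odd-2*+1 n) ⟩
  not (odd (maximum (heights B w)))
    ∎
  where
  open ≡-Reasoning
  B = 2 * n + 1
  w≤B : length w ≤ B
  w≤B = ≤-reflexive len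
  len′ : length (trail B w) ≡ suc (n * 2)
  len′ = trans (length-trail B w) (trans len (trans (+-comm (2 * n) 1) (cong suc (*-comm 2 n))))

length-filter-split : ∀ {A : Set} (f : A → Bool) (S : List A) →
  length S ≡ length (filter (λ a → f a Bool.≟ true) S) + length (filter (λ a → f a Bool.≟ false) S)
length-filter-split f [] = refl
length-filter-split f (a ∷ S) with f a
... | true  = cong suc (length-filter-split f S)
... | false = trans (cong suc (length-filter-split f S)) (sym (+-suc _ _))

module _ {X Y Z : Set} where

  announce : ℕ → ℕ → (X → ℕ) → (ℕ → Protocol X Y Z) → Protocol X Y Z
  announce zero    lo φ next = next lo
  announce (suc k) lo φ next =
    alice (λ x → lo + 2 ^ k ≤ᵇ φ x) (announce k lo φ next) (announce k (lo + 2 ^ k) φ next)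

  run-announce : ∀ k lo φ next x y → lo ≤ φ x → φ x < lo + 2 ^ k →
    run (announce k lo φ next) x y ≡ run (next (φ x)) x y
  run-announce zero lo φ next x y lo≤φ φ<lo+1 =
    cong (λ v → run (next v) x y) (≤-antisym lo≤φ (m<1+n⇒m≤n (subst (φ x <_) (+-comm lo 1) φ<lo+1)))
  run-announce (suc k) lo φ next x y lo≤φ φ<lo+2^k+2^k
    with lo + 2 ^ k ≤ᵇ φ x | ≤ᵇ-reflects-≤ (lo + 2 ^ k) (φ x)
  ... | true  | ofʸ mid≤φ =
    run-announce k (lo + 2 ^ k) φ next x y mid≤φ (subst (φ x <_) (halves lo (2 ^ k)) φ<lo+2^k+2^k)
    where
    halves : ∀ a b → a + 2 * b ≡ a + b + b
    halves a b = trans (cong (a +_) (cong (b +_) (+-identityʳ b))) (sym (+-assoc a b b))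
  ... | false | ofⁿ mid≰φ = run-announce k lo φ next x y lo≤φ (≰⇒> mid≰φ)

  depth-announce : ∀ k lo φ next d → (∀ v → depth (next v) ≤ d) →
    depth (announce k lo φ next) ≤ k + d
  depth-announce zero    lo φ next d bound = bound lo
  depth-announce (suc k) lo φ next d bound =
    s≤s (⊔-lub (depth-announce k lo φ next d bound) (depth-announce k (lo + 2 ^ k) φ next d bound))

  Separated : (X → Y → Z) → X × Y → X × Y → Set
  Separated h (x , y) (x′ , y′) = h x y′ ≡ h x y → h x′ y ≡ h x′ y′ → ⊥

  Fooling : (X → Y → Z) → List (X × Y) → Set
  Fooling h = AllPairs (Separated h)

  fooling-restrict : ∀ {P : X × Y → Set} {h h′ : X → Y → Z} →
    (∀ {s t} → P s → P t → h (proj₁ s) (proj₂ t) ≡ h′ (proj₁ s) (proj₂ t)) →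
    ∀ {S} → All P S → Fooling h S → Fooling h′ S
  fooling-restrict agree [] [] = []
  fooling-restrict {P} {h} {h′} agree (ps ∷ pS) (seps ∷ fooling) =
    All.zipWith separated (pS , seps) ∷ fooling-restrict agree pS fooling
    where
    separated : ∀ {t} → P t × Separated h _ t → Separated h′ _ t
    separated (pt , sep) e₁ e₂ =
      sep (trans (agree ps pt) (trans e₁ (sym (agree ps ps))))
          (trans (agree pt ps) (trans e₂ (sym (agree pt pt))))

  run-alice : ∀ {f b} (l r : Protocol X Y Z) {x} y → f x ≡ b →
    run (alice f l r) x y ≡ run (if b then r else l) x y
  run-alice {f} l r {x} y refl with f x
  ... | true  = refl
  ... | false = refl

  run-bob : ∀ {g b} (l r : Protocol X Y Z) x {y} → g y ≡ b →
    run (bob g l r) x y ≡ run (if b then r else l) x y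
  run-bob {g} l r x {y} refl with g y
  ... | true  = refl
  ... | false = refl

  fooling-split : ∀ (p l r : Protocol X Y Z) (branch : X × Y → Bool) →
    (∀ b {s t} → branch s ≡ b → branch t ≡ b →
      run p (proj₁ s) (proj₂ t) ≡ run (if b then r else l) (proj₁ s) (proj₂ t)) →
    (∀ {S} → Fooling (run l) S → length S ≤ 2 ^ depth l) →
    (∀ {S} → Fooling (run r) S → length S ≤ 2 ^ depth r) →
    ∀ {S} → Fooling (run p) S → length S ≤ 2 ^ suc (depth l ⊔ depth r)
  fooling-split p l r branch agree boundˡ boundʳ {S} fooling = begin
    length S
      ≡⟨ length-filter-split branch S ⟩
    length (class true) + length (class false)
      ≤⟨ +-mono-≤ (boundʳ (restrict true)) (boundˡ (restrict false)) ⟩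
    2 ^ depth r + 2 ^ depth l
      ≤⟨ +-mono-≤ (^-monoʳ-≤ 2 (m≤n⊔m (depth l) (depth r))) (^-monoʳ-≤ 2 (m≤m⊔n (depth l) (depth r))) ⟩
    2 ^ m + 2 ^ m
      ≡⟨ cong (2 ^ m +_) (+-identityʳ (2 ^ m)) ⟨
    2 ^ suc m
      ∎
    where
    open ≤-Reasoning
    m = depth l ⊔ depth r
    class : Bool → List (X × Y)
    class b = filter (λ s → branch s Bool.≟ b) S
    restrict : ∀ b → Fooling (run (if b then r else l)) (class b)
    restrict b = fooling-restrict (agree b) (all-filter _ S) (AllPairs.filter⁺ _ fooling)

  fooling-length : ∀ (p : Protocol X Y Z) {S} → Fooling (run p) S → length S ≤ 2 ^ depth p
  fooling-length (leaf z) []              = z≤n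
  fooling-length (leaf z) (_ ∷ [])        = s≤s z≤n
  fooling-length (leaf z) ((sep ∷ _) ∷ _) = ⊥-elim (sep refl refl)
  fooling-length p@(alice f l r) = fooling-split p l r (f ∘ proj₁)
    (λ _ fs≡b _ → run-alice {f} l r _ fs≡b) (fooling-length l) (fooling-length r)
  fooling-length p@(bob g l r)   = fooling-split p l r (g ∘ proj₂)
    (λ _ _ gt≡b → run-bob {g} l r _ gt≡b) (fooling-length l) (fooling-length r)

module _ {X Y : Set} where

  reply : (Y → Bool) → Protocol X Y Bool
  reply f = bob f (leaf false) (leaf true)

  run-reply : ∀ f x y → run (reply f) x y ≡ f y
  run-reply f x y with f y
  ... | true  = refl
  ... | false = refl

greaterThan-lower : ∀ {X Y : Set} k (x : ℕ → X) (y : ℕ → Y) (p : Protocol X Y Bool) →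
  (∀ {u t} → u ≤ k → t < k → run p (x u) (y t) ≡ (t <ᵇ u)) → k ≤ 2 ^ depth p
greaterThan-lower k x y p gt =
  subst (_≤ 2 ^ depth p) (length-applyUpTo pair k) (fooling-length p (AllPairs.applyUpTo⁺₁ pair k separated))
  where
  open ≡-Reasoning
  pair : ℕ → _
  pair t = x (suc t) , y t
  separated : ∀ {i j} → i < j → j < k → Separated (run p) (pair i) (pair j)
  separated {i} {j} i<j j<k e _ = true≢false $ begin
    true                        ≡⟨ dec-true (i <? suc i) (n<1+n i) ⟨
    i <ᵇ suc i                  ≡⟨ gt i<k i<k ⟨
    run p (x (suc i)) (y i)     ≡⟨ e ⟨
    run p (x (suc i)) (y j)     ≡⟨ gt i<k j<k ⟩
    j <ᵇ suc i                  ≡⟨ dec-false (j <? suc i) (λ j<1+i → <⇒≱ i<j (m<1+n⇒m≤n j<1+i)) ⟩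
    false                       ∎
    where
    i<k = <-trans i<j j<k
    true≢false : true ≢ false
    true≢false ()

toList-subst : ∀ {A : Set} {m n} (e : m ≡ n) (v : Vec A m) → toList (subst (Vec A) e v) ≡ toList v
toList-subst refl v = refl

pred184-cut : ∀ n {i j} (e : i + j ≡ 2 * n + 1) x y →
  cut (Pred 184 n) i j e x y ≡ not (odd (maximum (heights (2 * n + 1) (toList x ++ toList y))))
pred184-cut n e x y = begin
  headOr (iterate 184 n (toList (subst (Vec Bool) e (x Data.Vec.++ y))))
    ≡⟨ cong (headOr ∘ iterate 184 n) (trans (toList-subst e _) (toList-++ x y)) ⟩
  headOr (iterate 184 n (toList x ++ toList y))
    ≡⟨ pred184-maximum n _ len ⟩
  not (odd (maximum (heights (2 * n + 1) (toList x ++ toList y))))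
    ∎
  where
  open ≡-Reasoning
  len : length (toList x ++ toList y) ≡ 2 * n + 1
  len = trans (length-++ (toList x)) (trans (cong₂ _+_ (length-toList x) (length-toList y)) e)

maximum-heights-++ : ∀ h u v →
  maximum (heights h (u ++ v)) ≡ maximum (heights h u) ⊔ maximum (heights (endHeight h u) v)
maximum-heights-++ h []      v =
  solve 2 (λ h m → h ⊕ m ⊜ (h ⊕ id) ⊕ (h ⊕ m)) refl h (maximum (trail h v))
maximum-heights-++ h (b ∷ u) v =
  trans (cong (h ⊔_) (maximum-heights-++ (move b h) u v)) (sym (⊔-assoc h _ _))

move-≤ : ∀ b h → move b h ≤ suc h
move-≤ true  h = ≤-refl
move-≤ false h = ≤-trans pred[n]≤n (n≤1+n h)

maximum-heights-≤ : ∀ h w → maximum (heights h w) ≤ h + length w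
maximum-heights-≤ h []      = ⊔-lub (m≤m+n h 0) z≤n
maximum-heights-≤ h (b ∷ w) = ⊔-lub (m≤m+n h _) (begin
  maximum (heights (move b h) w) ≤⟨ maximum-heights-≤ (move b h) w ⟩
  move b h + length w            ≤⟨ +-monoˡ-≤ (length w) (move-≤ b h) ⟩
  suc h + length w               ≡⟨ +-suc h (length w) ⟨
  h + length (b ∷ w)             ∎)
  where open ≤-Reasoning

endHeight-≤-maximum : ∀ h w → endHeight h w ≤ maximum (heights h w)
endHeight-≤-maximum h []      = m≤m⊔n h 0
endHeight-≤-maximum h (b ∷ w) = ≤-trans (endHeight-≤-maximum (move b h) w) (m≤n⊔m h _)

pred184-cut-upper : ∀ n k {i j} (e : i + j ≡ 2 * n + 1) → 2 * (2 * n + 1) < 2 ^ k →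
  D₂≤ (cut (Pred 184 n) i j e) (k + (k + 1))
pred184-cut-upper n k {i} {j} e bound = protocol , correct ,
  depth-announce k 0 peak _ (k + 1) (λ m → depth-announce k 0 end _ 1 (λ _ → ≤-refl))
  where
  B = 2 * n + 1
  peak end : Vec Bool i → ℕ
  peak x = maximum (heights B (toList x))
  end  x = endHeight B (toList x)
  answer : ℕ → ℕ → Vec Bool j → Bool
  answer m h y = not (odd (m ⊔ maximum (heights h (toList y))))
  protocol : Protocol (Vec Bool i) (Vec Bool j) Bool
  protocol = announce k 0 peak (λ m → announce k 0 end (λ h → reply (answer m h)))
  peak<2^k : ∀ x → peak x < 2 ^ k
  peak<2^k x = ≤-<-trans (maximum-heights-≤ B (toList x)) (≤-<-trans (+-monoʳ-≤ B i≤B) bound′)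
    where
    i≤B : length (toList x) ≤ B
    i≤B = ≤-trans (≤-reflexive (length-toList x)) (≤-trans (m≤m+n i j) (≤-reflexive e))
    bound′ : B + B < 2 ^ k
    bound′ = subst (_< 2 ^ k) (cong (B +_) (+-identityʳ B)) bound
  correct : Computes protocol (cut (Pred 184 n) i j e)
  correct x y = begin
    run protocol x y
      ≡⟨ run-announce k 0 peak _ x y z≤n (peak<2^k x) ⟩
    run (announce k 0 end _) x y
      ≡⟨ run-announce k 0 end _ x y z≤n (≤-<-trans (endHeight-≤-maximum B (toList x)) (peak<2^k x)) ⟩
    run (reply (answer (peak x) (end x))) x y
      ≡⟨ run-reply (answer (peak x) (end x)) x y ⟩
    answer (peak x) (end x) y
      ≡⟨ cong (not ∘ odd) (maximum-heights-++ B (toList x) (toList y)) ⟨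
    not (odd (maximum (heights B (toList x ++ toList y))))
      ≡⟨ pred184-cut n e x y ⟨
    cut (Pred 184 n) i j e x y
      ∎
    where open ≡-Reasoning

head-≤-maximum : ∀ h w → h ≤ maximum (heights h w)
head-≤-maximum h w = m≤m⊔n h _

maximum-heights-ascent : ∀ a h w →
  maximum (heights h (replicate a true ++ w)) ≡ maximum (heights (a + h) w)
maximum-heights-ascent zero    h w = refl
maximum-heights-ascent (suc a) h w = begin
  h ⊔ maximum (heights (suc h) (replicate a true ++ w))
    ≡⟨ m≤n⇒m⊔n≡n (≤-trans (n≤1+n h) (head-≤-maximum (suc h) (replicate a true ++ w))) ⟩
  maximum (heights (suc h) (replicate a true ++ w))
    ≡⟨ maximum-heights-ascent a (suc h) w ⟩
  maximum (heights (a + suc h) w)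
    ≡⟨ cong (λ h′ → maximum (heights h′ w)) (+-suc a h) ⟩
  maximum (heights (suc a + h) w)
    ∎
  where open ≡-Reasoning

maximum-heights-descent : ∀ b h w →
  maximum (heights (b + h) (replicate b false ++ w)) ≡ (b + h) ⊔ maximum (heights h w)
maximum-heights-descent zero    h w = sym (m≤n⇒m⊔n≡n (head-≤-maximum h w))
maximum-heights-descent (suc b) h w = begin
  suc (b + h) ⊔ maximum (heights (b + h) (replicate b false ++ w))
    ≡⟨ cong (suc (b + h) ⊔_) (maximum-heights-descent b h w) ⟩
  suc (b + h) ⊔ ((b + h) ⊔ maximum (heights h w))
    ≡⟨ ⊔-assoc (suc (b + h)) (b + h) _ ⟨
  (suc (b + h) ⊔ (b + h)) ⊔ maximum (heights h w)
    ≡⟨ cong (_⊔ maximum (heights h w)) (m≥n⇒m⊔n≡m (n≤1+n (b + h))) ⟩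
  suc (b + h) ⊔ maximum (heights h w)
    ∎
  where open ≡-Reasoning

maximum-heights-valley : ∀ b c v →
  maximum (heights (b + v) (replicate b false ++ replicate c true)) ≡ (b + v) ⊔ (c + v)
maximum-heights-valley b c v = begin
  maximum (heights (b + v) (replicate b false ++ replicate c true))
    ≡⟨ maximum-heights-descent b v (replicate c true) ⟩
  (b + v) ⊔ maximum (heights v (replicate c true))
    ≡⟨ cong (λ w → (b + v) ⊔ maximum (heights v w)) (++-identityʳ (replicate c true)) ⟨
  (b + v) ⊔ maximum (heights v (replicate c true ++ []))
    ≡⟨ cong ((b + v) ⊔_) (maximum-heights-ascent c v []) ⟩
  (b + v) ⊔ ((c + v) ⊔ 0)
    ≡⟨ cong ((b + v) ⊔_) (⊔-identityʳ (c + v)) ⟩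
  (b + v) ⊔ (c + v)
    ∎
  where open ≡-Reasoning

block : Bool → (m k : ℕ) → Vec Bool m
block b zero    k       = []
block b (suc m) zero    = not b ∷ block b m zero
block b (suc m) (suc k) = b ∷ block b m k

toList-block : ∀ b k r → toList (block b (k + r) k) ≡ replicate k b ++ replicate r (not b)
toList-block b zero    zero    = refl
toList-block b zero    (suc r) = cong (not b ∷_) (toList-block b zero r)
toList-block b (suc k) r       = cong (b ∷_) (toList-block b k r)

replicate-+ : ∀ {A : Set} m n (x : A) → replicate (m + n) x ≡ replicate m x ++ replicate n x
replicate-+ zero    n x = refl
replicate-+ (suc m) n x = cong (x ∷_) (replicate-+ m n x)

odd-peak : ∀ u n → odd (2 * u + (2 * n + 1)) ≡ true
odd-peak u n = trans (odd-+ (2 * u) _) (cong₂ _xor_ (odd-2* u) (odd-2*+1 n))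

odd-end : ∀ u q → odd (q + (q + 4 * u)) ≡ false
odd-end u q = trans (cong odd (lemma u q)) (odd-2* (q + 2 * u))
  where
  lemma : ∀ u q → q + (q + 4 * u) ≡ 2 * (q + 2 * u)
  lemma = solve-∀

not-odd-peak⊔end : ∀ u t q → not (odd ((2 * u + (2 * (t + q) + 1)) ⊔ (q + (q + 4 * u)))) ≡ (t <ᵇ u)
not-odd-peak⊔end u t q with t <ᵇ u | <ᵇ-reflects-< t u
... | true  | ofʸ t<u =
  trans (cong (not ∘ odd) (m≤n⇒m⊔n≡n (peak≤end (proj₂ (m≤n⇒∃[o]m+o≡n t<u))))) (cong not (odd-end u q))
  where
  peak≤end : ∀ {k} → suc t + k ≡ u → 2 * u + (2 * (t + q) + 1) ≤ q + (q + 4 * u)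
  peak≤end {k} refl = ≤-trans (m≤m+n _ (suc (2 * k))) (≤-reflexive (lemma t k q))
    where
    lemma : ∀ t k q → 2 * (suc t + k) + (2 * (t + q) + 1) + suc (2 * k) ≡ q + (q + 4 * (suc t + k))
    lemma = solve-∀
... | false | ofⁿ t≮u =
  trans (cong (not ∘ odd) (m≥n⇒m⊔n≡m (end≤peak (proj₂ (m≤n⇒∃[o]m+o≡n (≮⇒≥ t≮u))))))
        (cong not (odd-peak u (t + q)))
  where
  end≤peak : ∀ {k} → u + k ≡ t → q + (q + 4 * u) ≤ 2 * u + (2 * (t + q) + 1)
  end≤peak {k} refl = ≤-trans (m≤m+n _ (suc (2 * k))) (≤-reflexive (lemma u k q))
    where
    lemma : ∀ u k q → q + (q + 4 * u) + suc (2 * k) ≡ 2 * u + (2 * ((u + k) + q) + 1)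
    lemma = solve-∀

maximum-heights-crossing : ∀ a b c h v → a + h ≡ b + v →
  maximum (heights h (replicate a true ++ (replicate b false ++ replicate c true))) ≡ (a + h) ⊔ (c + v)
maximum-heights-crossing a b c h v a+h≡b+v = begin
  maximum (heights h (replicate a true ++ W)) ≡⟨ maximum-heights-ascent a h W ⟩
  maximum (heights (a + h) W)                 ≡⟨ cong (λ p → maximum (heights p W)) a+h≡b+v ⟩
  maximum (heights (b + v) W)                 ≡⟨ maximum-heights-valley b c v ⟩
  (b + v) ⊔ (c + v)                           ≡⟨ cong (_⊔ (c + v)) a+h≡b+v ⟨
  (a + h) ⊔ (c + v)                           ∎
  where
  open ≡-Reasoning
  W = replicate b false ++ replicate c true

middle-cut : ∀ n → suc n + n ≡ 2 * n + 1
middle-cut = solve-∀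

pred184-greaterThan : ∀ n u t → 2 * u ≤ suc n → t ≤ n →
  cut (Pred 184 n) (suc n) n (middle-cut n) (block true (suc n) (2 * u)) (block false n t) ≡ (t <ᵇ u)
pred184-greaterThan n u t 2u≤1+n t≤n with m≤n⇒∃[o]m+o≡n 2u≤1+n | m≤n⇒∃[o]m+o≡n t≤n
... | r , 2u+r≡1+n | q , refl = begin
  cut (Pred 184 (t + q)) (suc (t + q)) (t + q) (middle-cut (t + q)) X Y
    ≡⟨ pred184-cut (t + q) (middle-cut (t + q)) X Y ⟩
  not (odd (maximum (heights B (toList X ++ toList Y))))
    ≡⟨ cong (λ w → not (odd (maximum (heights B w)))) word ⟩
  not (odd (maximum (heights B (replicate (2 * u) true ++ (replicate (r + t) false ++ replicate q true)))))
    ≡⟨ cong (not ∘ odd) (maximum-heights-crossing (2 * u) (r + t) q B (q + 4 * u) peak) ⟩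
  not (odd ((2 * u + B) ⊔ (q + (q + 4 * u))))
    ≡⟨ not-odd-peak⊔end u t q ⟩
  t <ᵇ u
    ∎
  where
  open ≡-Reasoning
  B = 2 * (t + q) + 1
  X = block true (suc (t + q)) (2 * u)
  Y = block false (t + q) t
  toList-X : toList X ≡ replicate (2 * u) true ++ replicate r false
  toList-X = subst (λ m → toList (block true m (2 * u)) ≡ replicate (2 * u) true ++ replicate r false)
                   2u+r≡1+n (toList-block true (2 * u) r)
  word : toList X ++ toList Y ≡ replicate (2 * u) true ++ (replicate (r + t) false ++ replicate q true)
  word = begin
    toList X ++ toList Y
      ≡⟨ cong₂ _++_ toList-X (toList-block false t q) ⟩
    (replicate (2 * u) true ++ replicate r false) ++ (replicate t false ++ replicate q true)
      ≡⟨ ++-assoc (replicate (2 * u) true) _ _ ⟩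
    replicate (2 * u) true ++ (replicate r false ++ (replicate t false ++ replicate q true))
      ≡⟨ cong (replicate (2 * u) true ++_) (++-assoc (replicate r false) _ _) ⟨
    replicate (2 * u) true ++ ((replicate r false ++ replicate t false) ++ replicate q true)
      ≡⟨ cong (λ z → replicate (2 * u) true ++ (z ++ replicate q true)) (replicate-+ r t false) ⟨
    replicate (2 * u) true ++ (replicate (r + t) false ++ replicate q true)
      ∎
  peak : 2 * u + B ≡ (r + t) + (q + 4 * u)
  peak = begin
    2 * u + B                          ≡⟨ regroup₁ u t q ⟩
    2 * u + (suc (t + q) + (t + q))    ≡⟨ cong (λ m → 2 * u + (m + (t + q))) 2u+r≡1+n ⟨
    2 * u + ((2 * u + r) + (t + q))    ≡⟨ regroup₂ u r t q ⟩
    (r + t) + (q + 4 * u)              ∎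
    where
    regroup₁ : ∀ u t q → 2 * u + (2 * (t + q) + 1) ≡ 2 * u + (suc (t + q) + (t + q))
    regroup₁ = solve-∀
    regroup₂ : ∀ u r t q → 2 * u + ((2 * u + r) + (t + q)) ≡ (r + t) + (q + 4 * u)
    regroup₂ = solve-∀

2*⌊n/2⌋≤n : ∀ n → 2 * ⌊ n /2⌋ ≤ n
2*⌊n/2⌋≤n n = begin
  ⌊ n /2⌋ + (⌊ n /2⌋ + 0) ≡⟨ cong (⌊ n /2⌋ +_) (+-identityʳ ⌊ n /2⌋) ⟩
  ⌊ n /2⌋ + ⌊ n /2⌋       ≤⟨ +-monoʳ-≤ ⌊ n /2⌋ (⌊n/2⌋≤⌈n/2⌉ n) ⟩
  ⌊ n /2⌋ + ⌈ n /2⌉       ≡⟨ ⌊n/2⌋+⌈n/2⌉≡n n ⟩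
  n                       ∎
  where open ≤-Reasoning

pred184-lower : ∀ n (p : Protocol (Vec Bool (suc n)) (Vec Bool n) Bool) →
  Computes p (cut (Pred 184 n) (suc n) n (middle-cut n)) → ⌊ n /2⌋ ≤ 2 ^ depth p
pred184-lower n p computes =
  greaterThan-lower ⌊ n /2⌋ (λ u → block true (suc n) (2 * u)) (block false n) p
    (λ {u} {t} u≤k t<k → trans (computes _ _) (pred184-greaterThan n u t
      (m≤n⇒m≤1+n (≤-trans (*-monoʳ-≤ 2 u≤k) (2*⌊n/2⌋≤n n)))
      (≤-trans (<⇒≤ t<k) (⌊n/2⌋≤n n))))

⌊log₂n⌋≤1+d : ∀ n d → ⌊ n /2⌋ ≤ 2 ^ d → ⌊log₂ n ⌋ ≤ suc d
⌊log₂n⌋≤1+d n d ⌊n/2⌋≤2^d = begin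
  ⌊log₂ n ⌋                ≤⟨ m≤n+m∸n ⌊log₂ n ⌋ 1 ⟩
  1 + (⌊log₂ n ⌋ ∸ 1)      ≡⟨ cong suc (⌊log₂⌊n/2⌋⌋≡⌊log₂n⌋∸1 n) ⟨
  1 + ⌊log₂ ⌊ n /2⌋ ⌋      ≤⟨ s≤s (⌊log₂⌋-mono-≤ ⌊n/2⌋≤2^d) ⟩
  1 + ⌊log₂ 2 ^ d ⌋        ≡⟨ cong suc (⌊log₂[2^n]⌋≡n d) ⟩
  suc d                    ∎
  where open ≤-Reasoning

n<2^[1+⌊log₂n⌋] : ∀ n → n < 2 ^ suc ⌊log₂ n ⌋
n<2^[1+⌊log₂n⌋] n with 2 ^ suc ⌊log₂ n ⌋ ≤? n
... | yes 2^[1+L]≤n =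
  ⊥-elim (1+n≰n (subst (_≤ ⌊log₂ n ⌋) (⌊log₂[2^n]⌋≡n _) (⌊log₂⌋-mono-≤ 2^[1+L]≤n)))
... | no  2^[1+L]≰n = ≰⇒> 2^[1+L]≰n

D₂≤-weaken : ∀ {X Y Z : Set} {g : X → Y → Z} {d d′} → d ≤ d′ → D₂≤ g d → D₂≤ g d′
D₂≤-weaken d≤d′ (p , computes , depth≤d) = p , computes , ≤-trans depth≤d d≤d′

pred184-upper : ∀ n L → 1 ≤ L → n < 2 ^ suc L → D≤ (Pred 184 n) (9 * L)
pred184-upper n (suc L) _ n<2^[1+L] i j e =
  D₂≤-weaken rounds (pred184-cut-upper n (3 + suc L) e bound)
  where
  bound : 2 * (2 * n + 1) < 2 ^ (3 + suc L)
  bound = ≤-trans (n≤1+n _) (≤-trans (≤-reflexive (lemma n)) (*-monoʳ-≤ 2 (*-monoʳ-≤ 2 n<2^[1+L])))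
    where
    lemma : ∀ n → 2 + 2 * (2 * n + 1) ≡ 2 * (2 * suc n)
    lemma = solve-∀
  rounds : (3 + suc L) + ((3 + suc L) + 1) ≤ 9 * suc L
  rounds = ≤-trans (m≤m+n _ (7 * L)) (≤-reflexive (lemma L))
    where
    lemma : ∀ L → (3 + suc L) + ((3 + suc L) + 1) + 7 * L ≡ 9 * suc L
    lemma = solve-∀

⌊log₂n⌋≤9*d : ∀ n d → 4 ≤ n → ⌊ n /2⌋ ≤ 2 ^ d → ⌊log₂ n ⌋ ≤ 9 * d
⌊log₂n⌋≤9*d n zero    4≤n ⌊n/2⌋≤1   =
  contradiction (≤-trans {2} (⌊n/2⌋-mono 4≤n) ⌊n/2⌋≤1) λ { (s≤s ()) }
⌊log₂n⌋≤9*d n (suc d) _   ⌊n/2⌋≤2^d = begin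
  ⌊log₂ n ⌋              ≤⟨ ⌊log₂n⌋≤1+d n (suc d) ⌊n/2⌋≤2^d ⟩
  2 + d                  ≤⟨ m≤m+n (2 + d) (7 + 8 * d) ⟩
  2 + d + (7 + 8 * d)    ≡⟨ lemma d ⟩
  9 * suc d              ∎
  where
  open ≤-Reasoning
  lemma : ∀ d → 2 + d + (7 + 8 * d) ≡ 9 * suc d
  lemma = solve-∀

2≤⌊log₂n⌋ : ∀ {n} → 4 ≤ n → 2 ≤ ⌊log₂ n ⌋
2≤⌊log₂n⌋ {n} 4≤n = subst (_≤ ⌊log₂ n ⌋) (⌊log₂[2^n]⌋≡n 2) (⌊log₂⌋-mono-≤ 4≤n)

proposition21 : Σ ℕ (λ c → Σ ℕ (λ N → ∀ n → N ≤ n →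
    D≤ (Pred 184 n) (c * ⌊log₂ n ⌋) × DLower (Pred 184 n) c ⌊log₂ n ⌋))
proposition21 = 9 , 4 , λ n 4≤n →
  pred184-upper n ⌊log₂ n ⌋ (≤-trans (s≤s z≤n) (2≤⌊log₂n⌋ 4≤n)) (n<2^[1+⌊log₂n⌋] n) ,
  (suc n , n , middle-cut n , λ p computes → ⌊log₂n⌋≤9*d n (depth p) 4≤n (pred184-lower n p computes))
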